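{- Assume $\mathsf{CT_Q}$. Let $\mathcal{M}$ be a model of $\mathsf{HA}$ such that $\mathsf{std}$ is stable and $\neg(\mathcal{M}\cong\mathbb{N})$, and let $p:\mathbb{N}\to\mathbb{P}$ be decidable. Then $\neg\neg\,\exists c:\mathcal{M}\ \forall n:\mathbb{N}.\ p\,n\leftrightarrow\mathcal{M}\vDash\overline{\pi(n)}\mid c$.
   Context: Meta-theory: constructive type theory (Calculus of Inductive Constructions), no classical axioms. A predicate $q$ is stable if $\neg\neg q\,x\to q\,x$ for all $x$; $p$ is decidable if $\exists f:\mathbb{N}\to\mathbb{B}.\ \forall x.\ p\,x\leftrightarrow f\,x=\mathsf{tt}$. $\pi:\mathbb{N}\to\mathbb{N}$ is a fixed injective function whose values are all primes. Arithmetic signature $0,S,+,\times,=$; $\mathsf{HA}$ is Heyting arithmetic (axioms for successor disjointness/injectivity, recursion equations for $+,\times$, equality axioms, induction scheme for all formulas, intuitionistic deduction); $\mathsf{Q}$ is Robinson arithmetic (no induction, plus $\forall x.\,x=0\lor\exists y.\,x=Sy$). A model $\mathcal{M}$ of $\mathsf{HA}$ is a type with interpretations of $0,S,+,\times$, $=$ interpreted as actual equality, satisfying the $\mathsf{HA}$ axioms under Tarski semantics. $\overline{n}$ is the numeral $S^n0$ and its value in $\mathcal{M}$; $x\mid y:=\exists k.\,x\times k=y$. $\mathsf{std}(e):=\exists n.\ \overline{n}=e$; $\mathcal{M}\cong\mathbb{N}$ means there is a bijective homomorphism $\mathbb{N}\to\mathcal{M}$. $\Delta_1$: for every substitution $\sigma$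 of closed terms $\mathsf{Q}\vdash\varphi[\sigma]$ or $\mathsf{Q}\vdash\neg\varphi[\sigma]$; $\Sigma_1$: $\exists x_1\dots\exists x_n.\varphi_0$ with $\varphi_0$ $\Delta_1$. $\mathsf{CT_Q}$: for every $f:\mathbb{N}\to\mathbb{N}$ there is a binary $\Sigma_1$-formula $\varphi_f(x,y)$ with $\mathsf{Q}\vdash\forall y.\,\varphi_f(\overline{n},y)\leftrightarrow\overline{f\,n}=y$ for every $n$. -}

module Defs where

open import Data.Nat using (ℕ; zero; suc; _<_)
import Data.Nat
open import Data.Bool using (Bool; true)
open import Data.List using (List; []; _∷_)
open import Data.List.Membership.Propositional using (_∈_)
open import Data.List.Relation.Unary.All using (All)
open import Data.Product using (Σ; _×_; _,_)
open import Data.Sum using (_⊎_)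
open import Data.Empty using (⊥)
open import Relation.Nullary using (¬_)
open import Relation.Binary.PropositionalEquality using (_≡_)
open import Function.Bundles using (_⇔_)

infixl 7 _⊗_
infixl 6 _⊕_
infix  4 _==_
infixr 2 _⇒_
infix  1 _⇔'_
infixr 3 _∧'_
infixr 3 _∨'_

data Term : Set where
  var  : ℕ → Term
  zer  : Term
  succ : Term → Term
  _⊕_  : Term → Term → Term
  _⊗_  : Term → Term → Term

data Form : Set where
  ⊥'   : Form
  _==_ : Term → Term → Form
  _∧'_ : Form → Form → Form
  _∨'_ : Form → Form → Form
  _⇒_  : Form → Form → Form
  ∀'   : Form → Form
  ∃'   : Form → Form

¬' : Form → Form
¬' φ = φ ⇒ ⊥'

_⇔'_ : Form → Form → Form
φ ⇔' ψ = (φ ⇒ ψ) ∧' (ψ ⇒ φ)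

num : ℕ → Term
num zero    = zer
num (suc n) = succ (num n)

tsubst : (ℕ → Term) → Term → Term
tsubst σ (var n)  = σ n
tsubst σ zer      = zer
tsubst σ (succ t) = succ (tsubst σ t)
tsubst σ (t ⊕ s)  = tsubst σ t ⊕ tsubst σ s
tsubst σ (t ⊗ s)  = tsubst σ t ⊗ tsubst σ s

tshift : Term → Term
tshift = tsubst (λ n → var (suc n))

up : (ℕ → Term) → ℕ → Term
up σ zero    = var zero
up σ (suc n) = tshift (σ n)

fsubst : (ℕ → Term) → Form → Form
fsubst σ ⊥'       = ⊥'
fsubst σ (t == s) = tsubst σ t == tsubst σ s
fsubst σ (φ ∧' ψ) = fsubst σ φ ∧' fsubst σ ψ
fsubst σ (φ ∨' ψ) = fsubst σ φ ∨' fsubst σ ψ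
fsubst σ (φ ⇒ ψ)  = fsubst σ φ ⇒ fsubst σ ψ
fsubst σ (∀' φ)   = ∀' (fsubst (up σ) φ)
fsubst σ (∃' φ)   = ∃' (fsubst (up σ) φ)

fshift : Form → Form
fshift = fsubst (λ n → var (suc n))

inst : Term → ℕ → Term
inst t zero    = t
inst t (suc n) = var n

_[_] : Form → Term → Form
φ [ t ] = fsubst (inst t) φ

mapF : (Form → Form) → List Form → List Form
mapF f []       = []
mapF f (φ ∷ Γ) = f φ ∷ mapF f Γ

infix 0 _⊢_
data _⊢_ : List Form → Form → Set where
  ctx  : ∀ {Γ φ} → φ ∈ Γ → Γ ⊢ φ
  exp  : ∀ {Γ φ} → Γ ⊢ ⊥' → Γ ⊢ φ
  ⇒I   : ∀ {Γ φ ψ} → (φ ∷ Γ) ⊢ ψ → Γ ⊢ φ ⇒ ψ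
  ⇒E   : ∀ {Γ φ ψ} → Γ ⊢ φ ⇒ ψ → Γ ⊢ φ → Γ ⊢ ψ
  ∧I   : ∀ {Γ φ ψ} → Γ ⊢ φ → Γ ⊢ ψ → Γ ⊢ φ ∧' ψ
  ∧E₁  : ∀ {Γ φ ψ} → Γ ⊢ φ ∧' ψ → Γ ⊢ φ
  ∧E₂  : ∀ {Γ φ ψ} → Γ ⊢ φ ∧' ψ → Γ ⊢ ψ
  ∨I₁  : ∀ {Γ φ ψ} → Γ ⊢ φ → Γ ⊢ φ ∨' ψ
  ∨I₂  : ∀ {Γ φ ψ} → Γ ⊢ ψ → Γ ⊢ φ ∨' ψ
  ∨E   : ∀ {Γ φ ψ θ} → Γ ⊢ φ ∨' ψ → (φ ∷ Γ) ⊢ θ → (ψ ∷ Γ) ⊢ θ → Γ ⊢ θ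
  ∀I   : ∀ {Γ φ} → mapF fshift Γ ⊢ φ → Γ ⊢ ∀' φ
  ∀E   : ∀ {Γ φ} (t : Term) → Γ ⊢ ∀' φ → Γ ⊢ φ [ t ]
  ∃I   : ∀ {Γ φ} (t : Term) → Γ ⊢ φ [ t ] → Γ ⊢ ∃' φ
  ∃E   : ∀ {Γ φ ψ} → Γ ⊢ ∃' φ → (φ ∷ mapF fshift Γ) ⊢ fshift ψ → Γ ⊢ ψ

_⊢T_ : (Form → Set) → Form → Set
T ⊢T φ = Σ (List Form) λ Γ → All T Γ × (Γ ⊢ φ)

v0 v1 v2 v3 : Term
v0 = var 0
v1 = var 1
v2 = var 2
v3 = var 3

-- equality axioms, successor axioms, recursion equations
-- (variable bound by the innermost ∀ is var 0)
baseAxioms : List Form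
baseAxioms =
    ∀' (v0 == v0)
  ∷ ∀' (∀' (v1 == v0 ⇒ v0 == v1))
  ∷ ∀' (∀' (∀' (v2 == v1 ⇒ v1 == v0 ⇒ v2 == v0)))
  ∷ ∀' (∀' (v1 == v0 ⇒ succ v1 == succ v0))
  ∷ ∀' (∀' (∀' (∀' (v3 == v2 ⇒ v1 == v0 ⇒ v3 ⊕ v1 == v2 ⊕ v0))))
  ∷ ∀' (∀' (∀' (∀' (v3 == v2 ⇒ v1 == v0 ⇒ v3 ⊗ v1 == v2 ⊗ v0))))
  ∷ ∀' (¬' (zer == succ v0))
  ∷ ∀' (∀' (succ v1 == succ v0 ⇒ v1 == v0))
  ∷ ∀' (zer ⊕ v0 == v0)
  ∷ ∀' (∀' (succ v1 ⊕ v0 == succ (v1 ⊕ v0)))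
  ∷ ∀' (zer ⊗ v0 == zer)
  ∷ ∀' (∀' (succ v1 ⊗ v0 == v0 ⊕ (v1 ⊗ v0)))
  ∷ []

caseAxiom : Form
caseAxiom = ∀' (v0 == zer ∨' ∃' (v1 == succ v0))

QAx : Form → Set
QAx φ = φ ∈ (caseAxiom ∷ baseAxioms)

Q⊢ : Form → Set
Q⊢ φ = QAx ⊢T φ

-- induction scheme instance for φ (var 0 is the induction variable,
-- other free variables are parameters)
stepσ : ℕ → Term
stepσ zero    = succ (var zero)
stepσ (suc n) = var (suc n)

indAx : Form → Form
indAx φ = φ [ zer ] ⇒ ∀' (φ ⇒ fsubst stepσ φ) ⇒ ∀' φ

HAAx : Form → Set
HAAx φ = (φ ∈ baseAxioms) ⊎ Σ Form (λ ψ → φ ≡ indAx ψ)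

data ClosedT : Term → Set where
  c-zer  : ClosedT zer
  c-succ : ∀ {t} → ClosedT t → ClosedT (succ t)
  c-⊕    : ∀ {t s} → ClosedT t → ClosedT s → ClosedT (t ⊕ s)
  c-⊗    : ∀ {t s} → ClosedT t → ClosedT s → ClosedT (t ⊗ s)

Δ₁ : Form → Set
Δ₁ φ = (σ : ℕ → Term) → (∀ n → ClosedT (σ n)) →
       Q⊢ (fsubst σ φ) ⊎ Q⊢ (¬' (fsubst σ φ))

data Σ₁ : Form → Set where
  Σ₁-Δ₁ : ∀ {φ} → Δ₁ φ → Σ₁ φ
  Σ₁-∃  : ∀ {φ} → Σ₁ φ → Σ₁ (∃' φ)

data BoundT (n : ℕ) : Term → Set where
  b-var  : ∀ {m} → m < n → BoundT n (var m)
  b-zer  : BoundT n zer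
  b-succ : ∀ {t} → BoundT n t → BoundT n (succ t)
  b-⊕    : ∀ {t s} → BoundT n t → BoundT n s → BoundT n (t ⊕ s)
  b-⊗    : ∀ {t s} → BoundT n t → BoundT n s → BoundT n (t ⊗ s)

data BoundF : ℕ → Form → Set where
  b-⊥  : ∀ {n} → BoundF n ⊥'
  b-== : ∀ {n t s} → BoundT n t → BoundT n s → BoundF n (t == s)
  b-∧  : ∀ {n φ ψ} → BoundF n φ → BoundF n ψ → BoundF n (φ ∧' ψ)
  b-∨  : ∀ {n φ ψ} → BoundF n φ → BoundF n ψ → BoundF n (φ ∨' ψ)
  b-⇒  : ∀ {n φ ψ} → BoundF n φ → BoundF n ψ → BoundF n (φ ⇒ ψ)
  b-∀  : ∀ {n φ} → BoundF (suc n) φ → BoundF n (∀' φ)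
  b-∃  : ∀ {n φ} → BoundF (suc n) φ → BoundF n (∃' φ)

-- φ(x,y) with x = var 1, y = var 0; φ(n̄, y) under a binder for y
repσ : ℕ → ℕ → Term
repσ n zero          = var zero
repσ n (suc zero)    = num n
repσ n (suc (suc m)) = var (suc (suc m))

CT-Q : Set
CT-Q = (f : ℕ → ℕ) → Σ Form λ φ → BoundF 2 φ × Σ₁ φ ×
       (∀ n → Q⊢ (∀' (fsubst (repσ n) φ ⇔' (num (f n) == var zero))))

record Model : Set₁ where
  field
    D    : Set
    z    : D
    s    : D → D
    add  : D → D → D
    mul  : D → D → D

module _ (M : Model) where
  open Model M

  eval : (ℕ → D) → Term → D
  eval ρ (var n)  = ρ n
  eval ρ zer      = z
  eval ρ (succ t) = s (eval ρ t)
  eval ρ (t ⊕ u)  = add (eval ρ t) (eval ρ u)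
  eval ρ (t ⊗ u)  = mul (eval ρ t) (eval ρ u)

  _∷ₑ_ : D → (ℕ → D) → ℕ → D
  (d ∷ₑ ρ) zero    = d
  (d ∷ₑ ρ) (suc n) = ρ n

  sat : (ℕ → D) → Form → Set
  sat ρ ⊥'       = ⊥
  sat ρ (t == u) = eval ρ t ≡ eval ρ u
  sat ρ (φ ∧' ψ) = sat ρ φ × sat ρ ψ
  sat ρ (φ ∨' ψ) = sat ρ φ ⊎ sat ρ ψ
  sat ρ (φ ⇒ ψ)  = sat ρ φ → sat ρ ψ
  sat ρ (∀' φ)   = (d : D) → sat (d ∷ₑ ρ) φ
  sat ρ (∃' φ)   = Σ D λ d → sat (d ∷ₑ ρ) φ

  IsHAModel : Set
  IsHAModel = ∀ φ → HAAx φ → (ρ : ℕ → D) → sat ρ φ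

  numM : ℕ → D
  numM n = eval (λ _ → z) (num n)

  std : D → Set
  std e = Σ ℕ λ n → numM n ≡ e

  IsoToℕ : Set
  IsoToℕ = Σ (ℕ → D) λ h →
      (h 0 ≡ z)
    × (∀ n → h (suc n) ≡ s (h n))
    × (∀ m n → h (m Data.Nat.+ n) ≡ add (h m) (h n))
    × (∀ m n → h (m Data.Nat.* n) ≡ mul (h m) (h n))
    × (∀ m n → h m ≡ h n → m ≡ n)
    × (∀ d → Σ ℕ λ n → h n ≡ d)

_∣'_ : Term → Term → Form
t ∣' u = ∃' (tshift t ⊗ var zero == tshift u)

Stable : {A : Set} → (A → Set) → Set
Stable q = ∀ x → ¬ ¬ q x → q x

DecidablePred : (ℕ → Set) → Set
DecidablePred p = Σ (ℕ → Bool) λ f → ∀ x → p x ⇔ (f x ≡ true)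

-- By CT_Q, π and the indicator of p are represented in Q, hence in M, by formulas φπ and φp.
-- For standard n the number c = ∏ {π u ∣ u < n, p u} satisfies
--   Φ(x) := ∃c ∀u < x ∀y. φπ(u, y) → (y ∣ c ↔ φp(u, 1))
-- at x = n̄, since M computes divisibility of standard numbers correctly.  Overspill: if Φ held
-- at no nonstandard element, then by stability of std every element satisfying Φ would be
-- standard, so Φ would be inductive and M would consist of numerals only, i.e. M ≅ ℕ.
-- Hence ¬¬ Φ(e) for some nonstandard e, and since every numeral lies below e, the witness c
-- of Φ(e) is divisible by π(n) exactly when p n.
module Submission where

open import Defs
open import Data.Nat using (ℕ)
open import Data.Nat.Primality using (Prime)
open import Data.Product using (Σ)
open import Relation.Nullary using (¬_)
open import Relation.Binary.PropositionalEquality using (_≡_)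
open import Function.Bundles using (_⇔_)

open import Data.Bool using (Bool; true; false; if_then_else_)
open import Data.Empty using (⊥; ⊥-elim)
open import Data.Fin using (#_)
open import Data.List.Membership.Propositional using (_∈_)
open import Data.List.Membership.Propositional.Properties using (∈-lookup)
open import Data.List.Relation.Unary.All as All using (All; []; _∷_)
open import Data.List.Relation.Unary.Any using (here; there)
open import Data.Nat using (zero; suc; _+_; _*_; _≤_; _<_)
open import Data.Nat.Divisibility using (_∣_; divides; ∣-refl; ∣-trans; ∣1⇒≡1; m∣m*n; n∣m*n)
open import Data.Nat.Primality using (¬prime[1]; euclidsLemma; prime⇒irreducible)
open import Data.Nat.Properties using (*-comm; m≤m+n; n<1+n; m<n⇒m<1+n; m<1+n⇒m<n∨m≡n)
open import Data.Product using (_×_; _,_; proj₁; proj₂; map₁)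
open import Data.Product.Function.Dependent.Propositional using (congˡ)
open import Data.Product.Function.NonDependent.Propositional using (_×-⇔_)
open import Data.Sum using (inj₁; inj₂; _⊎_)
open import Data.Sum.Function.Propositional using (_⊎-⇔_)
open import Function using (_∘_)
open import Function.Bundles using (mk⇔; Equivalence)
open import Function.Properties.Equivalence using ()
  renaming (refl to ⇔-refl; sym to ⇔-sym; trans to ⇔-trans)
open import Function.Related.Propositional using (equivalence; module EquationalReasoning)
open import Function.Related.TypeIsomorphisms using (→-cong-⇔)
open import Relation.Binary.PropositionalEquality
  using (refl; sym; trans; cong; cong₂; subst; subst₂; module ≡-Reasoning)
open import Relation.Nullary.Negation using (¬¬-map)

open Equivalence using (to; from)

Π-cong-⇔ : {A : Set} {P Q : A → Set} → (∀ a → P a ⇔ Q a) → ((a : A) → P a) ⇔ ((a : A) → Q a)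
Π-cong-⇔ P⇔Q = mk⇔ (λ f a → to (P⇔Q a) (f a)) (λ g a → from (P⇔Q a) (g a))

prime∣prime⇒≡ : ∀ {p q} → Prime p → Prime q → p ∣ q → p ≡ q
prime∣prime⇒≡ pp pq p∣q with prime⇒irreducible pq p∣q
... | inj₁ refl = ⊥-elim (¬prime[1] pp)
... | inj₂ p≡q  = p≡q

infix 4 _<'_
_<'_ : Term → Term → Form
t <' u = ∃' (succ (tshift t) ⊕ var zero == tshift u)

indicator : (ℕ → Bool) → ℕ → ℕ
indicator f n = if f n then 1 else 0

1≡indicator⇔ : ∀ f n → 1 ≡ indicator f n ⇔ f n ≡ true
1≡indicator⇔ f n with f n
... | true  = mk⇔ (λ _ → refl) (λ _ → refl)
... | false = mk⇔ (λ ()) (λ ())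

module Coding (π : ℕ → ℕ) (π-injective : ∀ m n → π m ≡ π n → m ≡ n)
              (π-prime : ∀ n → Prime (π n)) (f : ℕ → Bool) where

  code : ℕ → ℕ
  code zero    = 1
  code (suc n) = if f n then code n * π n else code n

  code∣code-suc : ∀ n → code n ∣ code (suc n)
  code∣code-suc n with f n
  ... | true  = m∣m*n (π n)
  ... | false = ∣-refl

  π∣code⇒ : ∀ u n → π u ∣ code n → u < n × f u ≡ true
  π∣code⇒ u zero    π∣1 = ⊥-elim (¬prime[1] (subst Prime (∣1⇒≡1 π∣1) (π-prime u)))
  π∣code⇒ u (suc n) π∣c with f n in fn≡
  ... | false = map₁ m<n⇒m<1+n (π∣code⇒ u n π∣c)
  ... | true with euclidsLemma (code n) (π n) (π-prime u) π∣c
  ...   | inj₁ π∣code = map₁ m<n⇒m<1+n (π∣code⇒ u n π∣code)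
  ...   | inj₂ πu∣πn with π-injective u n (prime∣prime⇒≡ (π-prime u) (π-prime n) πu∣πn)
  ...     | refl = n<1+n u , fn≡

  π∣code⇐ : ∀ u n → u < n → f u ≡ true → π u ∣ code n
  π∣code⇐ u (suc n) u<1+n fu with m<1+n⇒m<n∨m≡n u<1+n
  ... | inj₁ u<n = ∣-trans (π∣code⇐ u n u<n fu) (code∣code-suc n)
  ... | inj₂ refl rewrite fu = n∣m*n (code u)

  π∣code⇔ : ∀ u n → π u ∣ code n ⇔ (u < n × f u ≡ true)
  π∣code⇔ u n = mk⇔ (π∣code⇒ u n) (λ (u<n , fu) → π∣code⇐ u n u<n fu)

module _ (M : Model) where
  open Model M

  infixr 5 _◂_
  _◂_ : D → (ℕ → D) → ℕ → D
  _◂_ = _∷ₑ_ M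

  infix 8 ⟦_⟧_
  ⟦_⟧_ : Term → (ℕ → D) → D
  ⟦ t ⟧ ρ = eval M ρ t

  infix 4 _⊨_
  _⊨_ : (ℕ → D) → Form → Set
  ρ ⊨ φ = sat M ρ φ

  ρ₀ : ℕ → D
  ρ₀ _ = z

  ⌜_⌝ : ℕ → D
  ⌜_⌝ = numM M

  infix 4 _<ᴹ_ _∣ᴹ_
  _<ᴹ_ : D → D → Set
  u <ᴹ x = Σ D λ k → add (s u) k ≡ x

  _∣ᴹ_ : D → D → Set
  y ∣ᴹ c = Σ D λ k → mul y k ≡ c

  eval-tsubst : ∀ {σ ρ ρ′} → (∀ n → ⟦ σ n ⟧ ρ ≡ ρ′ n) → ∀ t → ⟦ tsubst σ t ⟧ ρ ≡ ⟦ t ⟧ ρ′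
  eval-tsubst σρ≡ρ′ (var n)  = σρ≡ρ′ n
  eval-tsubst σρ≡ρ′ zer      = refl
  eval-tsubst σρ≡ρ′ (succ t) = cong s (eval-tsubst σρ≡ρ′ t)
  eval-tsubst σρ≡ρ′ (t ⊕ u)  = cong₂ add (eval-tsubst σρ≡ρ′ t) (eval-tsubst σρ≡ρ′ u)
  eval-tsubst σρ≡ρ′ (t ⊗ u)  = cong₂ mul (eval-tsubst σρ≡ρ′ t) (eval-tsubst σρ≡ρ′ u)

  eval-tshift : ∀ t d ρ → ⟦ tshift t ⟧ (d ◂ ρ) ≡ ⟦ t ⟧ ρ
  eval-tshift t d ρ = eval-tsubst (λ _ → refl) t

  eval-up : ∀ {σ ρ ρ′} → (∀ n → ⟦ σ n ⟧ ρ ≡ ρ′ n) → ∀ d n → ⟦ up σ n ⟧ (d ◂ ρ) ≡ (d ◂ ρ′) n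
  eval-up σρ≡ρ′ d zero             = refl
  eval-up {σ} {ρ} σρ≡ρ′ d (suc n) = trans (eval-tshift (σ n) d ρ) (σρ≡ρ′ n)

  eval-num : ∀ n ρ → ⟦ num n ⟧ ρ ≡ ⌜ n ⌝
  eval-num zero    ρ = refl
  eval-num (suc n) ρ = cong s (eval-num n ρ)

  sat-fsubst : ∀ φ {σ ρ ρ′} → (∀ n → ⟦ σ n ⟧ ρ ≡ ρ′ n) → ρ ⊨ fsubst σ φ ⇔ ρ′ ⊨ φ
  sat-fsubst ⊥'       σρ≡ρ′ = ⇔-refl
  sat-fsubst (t == u) σρ≡ρ′ = mk⇔ (subst₂ _≡_ (eval-tsubst σρ≡ρ′ t) (eval-tsubst σρ≡ρ′ u))
                                  (subst₂ _≡_ (sym (eval-tsubst σρ≡ρ′ t)) (sym (eval-tsubst σρ≡ρ′ u)))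
  sat-fsubst (φ ∧' ψ) σρ≡ρ′ = sat-fsubst φ σρ≡ρ′ ×-⇔ sat-fsubst ψ σρ≡ρ′
  sat-fsubst (φ ∨' ψ) σρ≡ρ′ = sat-fsubst φ σρ≡ρ′ ⊎-⇔ sat-fsubst ψ σρ≡ρ′
  sat-fsubst (φ ⇒ ψ)  σρ≡ρ′ = →-cong-⇔ (sat-fsubst φ σρ≡ρ′) (sat-fsubst ψ σρ≡ρ′)
  sat-fsubst (∀' φ)   σρ≡ρ′ = Π-cong-⇔ λ d → sat-fsubst φ (eval-up σρ≡ρ′ d)
  sat-fsubst (∃' φ)   σρ≡ρ′ = congˡ {k = equivalence} λ {d} → sat-fsubst φ (eval-up σρ≡ρ′ d)

  sat-fshift : ∀ φ d ρ → (d ◂ ρ) ⊨ fshift φ ⇔ ρ ⊨ φ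
  sat-fshift φ d ρ = sat-fsubst φ (λ _ → refl)

  sat-inst : ∀ φ t ρ → ρ ⊨ φ [ t ] ⇔ (⟦ t ⟧ ρ ◂ ρ) ⊨ φ
  sat-inst φ t ρ = sat-fsubst φ inst≡
    where
    inst≡ : ∀ n → ⟦ inst t n ⟧ ρ ≡ (⟦ t ⟧ ρ ◂ ρ) n
    inst≡ zero    = refl
    inst≡ (suc n) = refl

  sat-numeral-∣' : ∀ q t ρ → ρ ⊨ (num q ∣' t) ⇔ ⌜ q ⌝ ∣ᴹ ⟦ t ⟧ ρ
  sat-numeral-∣' q t ρ = congˡ {k = equivalence} λ {k} →
    mk⇔ (subst₂ (λ a b → mul a k ≡ b) (q≡ k) (eval-tshift t k ρ))
        (subst₂ (λ a b → mul a k ≡ b) (sym (q≡ k)) (sym (eval-tshift t k ρ)))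
    where
    q≡ : ∀ k → ⟦ tshift (num q) ⟧ (k ◂ ρ) ≡ ⌜ q ⌝
    q≡ k = trans (eval-tshift (num q) k ρ) (eval-num q ρ)

  args₂ : Term → Term → ℕ → Term
  args₂ x y zero          = y
  args₂ x y (suc zero)    = x
  args₂ x y (suc (suc _)) = zer

  sat-args₂ : ∀ φ x y ρ → ρ ⊨ fsubst (args₂ x y) φ ⇔ (⟦ y ⟧ ρ ◂ ⟦ x ⟧ ρ ◂ ρ₀) ⊨ φ
  sat-args₂ φ x y ρ = sat-fsubst φ args₂≡
    where
    args₂≡ : ∀ n → ⟦ args₂ x y n ⟧ ρ ≡ (⟦ y ⟧ ρ ◂ ⟦ x ⟧ ρ ◂ ρ₀) n
    args₂≡ zero          = refl
    args₂≡ (suc zero)    = refl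
    args₂≡ (suc (suc _)) = refl

  All-fshift : ∀ {Γ ρ} d → All (ρ ⊨_) Γ → All ((d ◂ ρ) ⊨_) (mapF fshift Γ)
  All-fshift d []               = []
  All-fshift d (_∷_ {φ} ⊨φ ⊨Γ) = from (sat-fshift φ d _) ⊨φ ∷ All-fshift d ⊨Γ

  soundness : ∀ {Γ φ} → Γ ⊢ φ → ∀ ρ → All (ρ ⊨_) Γ → ρ ⊨ φ
  soundness (ctx φ∈Γ) ρ ⊨Γ = All.lookup ⊨Γ φ∈Γ
  soundness (exp ⊢⊥)  ρ ⊨Γ = ⊥-elim (soundness ⊢⊥ ρ ⊨Γ)
  soundness (⇒I ⊢ψ)   ρ ⊨Γ = λ ⊨φ → soundness ⊢ψ ρ (⊨φ ∷ ⊨Γ)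
  soundness (⇒E ⊢φ⇒ψ ⊢φ) ρ ⊨Γ = soundness ⊢φ⇒ψ ρ ⊨Γ (soundness ⊢φ ρ ⊨Γ)
  soundness (∧I ⊢φ ⊢ψ) ρ ⊨Γ = soundness ⊢φ ρ ⊨Γ , soundness ⊢ψ ρ ⊨Γ
  soundness (∧E₁ ⊢φ∧ψ) ρ ⊨Γ = proj₁ (soundness ⊢φ∧ψ ρ ⊨Γ)
  soundness (∧E₂ ⊢φ∧ψ) ρ ⊨Γ = proj₂ (soundness ⊢φ∧ψ ρ ⊨Γ)
  soundness (∨I₁ ⊢φ)  ρ ⊨Γ = inj₁ (soundness ⊢φ ρ ⊨Γ)
  soundness (∨I₂ ⊢ψ)  ρ ⊨Γ = inj₂ (soundness ⊢ψ ρ ⊨Γ)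
  soundness (∨E ⊢φ∨ψ ⊢θ₁ ⊢θ₂) ρ ⊨Γ with soundness ⊢φ∨ψ ρ ⊨Γ
  ... | inj₁ ⊨φ = soundness ⊢θ₁ ρ (⊨φ ∷ ⊨Γ)
  ... | inj₂ ⊨ψ = soundness ⊢θ₂ ρ (⊨ψ ∷ ⊨Γ)
  soundness (∀I ⊢φ) ρ ⊨Γ = λ d → soundness ⊢φ (d ◂ ρ) (All-fshift d ⊨Γ)
  soundness (∀E {φ = φ} t ⊢∀φ) ρ ⊨Γ = from (sat-inst φ t ρ) (soundness ⊢∀φ ρ ⊨Γ (⟦ t ⟧ ρ))
  soundness (∃I {φ = φ} t ⊢φt) ρ ⊨Γ = ⟦ t ⟧ ρ , to (sat-inst φ t ρ) (soundness ⊢φt ρ ⊨Γ)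
  soundness (∃E {ψ = ψ} ⊢∃φ ⊢ψ) ρ ⊨Γ with soundness ⊢∃φ ρ ⊨Γ
  ... | d , ⊨φ = to (sat-fshift ψ d ρ) (soundness ⊢ψ (d ◂ ρ) (⊨φ ∷ All-fshift d ⊨Γ))

  Represents : Form → (ℕ → ℕ) → Set
  Represents φ g = ∀ n y → (y ◂ ⌜ n ⌝ ◂ ρ₀) ⊨ φ ⇔ y ≡ ⌜ g n ⌝

  module _ (HA : IsHAModel M) where

    baseAxiom : ∀ {φ} → φ ∈ baseAxioms → ∀ ρ → ρ ⊨ φ
    baseAxiom φ∈ = HA _ (inj₁ φ∈)

    zero≢suc : ∀ d → z ≡ s d → ⊥
    zero≢suc = baseAxiom (∈-lookup (# 6)) ρ₀

    suc-injective : ∀ a b → s a ≡ s b → a ≡ b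
    suc-injective = baseAxiom (∈-lookup (# 7)) ρ₀

    zero-add : ∀ d → add z d ≡ d
    zero-add = baseAxiom (∈-lookup (# 8)) ρ₀

    suc-add : ∀ a b → add (s a) b ≡ s (add a b)
    suc-add = baseAxiom (∈-lookup (# 9)) ρ₀

    zero-mul : ∀ d → mul z d ≡ z
    zero-mul = baseAxiom (∈-lookup (# 10)) ρ₀

    suc-mul : ∀ a b → mul (s a) b ≡ add b (mul a b)
    suc-mul = baseAxiom (∈-lookup (# 11)) ρ₀

    induction : ∀ ψ ρ → (z ◂ ρ) ⊨ ψ → (∀ d → (d ◂ ρ) ⊨ ψ → (s d ◂ ρ) ⊨ ψ) → ∀ d → (d ◂ ρ) ⊨ ψ
    induction ψ ρ base step =
      HA (indAx ψ) (inj₂ (ψ , refl)) ρ (from (sat-inst ψ zer ρ) base)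
         (λ d → from (sat-fsubst ψ (stepσ≡ d)) ∘ step d)
      where
      stepσ≡ : ∀ d n → ⟦ stepσ n ⟧ (d ◂ ρ) ≡ (s d ◂ ρ) n
      stepσ≡ d zero    = refl
      stepσ≡ d (suc n) = refl

    caseAxiom-valid : ∀ ρ → ρ ⊨ caseAxiom
    caseAxiom-valid ρ = induction (v0 == zer ∨' ∃' (v1 == succ v0)) ρ (inj₁ refl) (λ d _ → inj₂ (d , refl))

    zero-or-suc : ∀ d → d ≡ z ⊎ Σ D (λ y → d ≡ s y)
    zero-or-suc = caseAxiom-valid ρ₀

    Q-soundness : ∀ {φ} → Q⊢ φ → ∀ ρ → ρ ⊨ φ
    Q-soundness (Γ , QΓ , Γ⊢φ) ρ = soundness Γ⊢φ ρ (All.map (λ ax → QAx-valid ax ρ) QΓ)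
      where
      QAx-valid : ∀ {φ} → QAx φ → ∀ ρ → ρ ⊨ φ
      QAx-valid (here refl) = caseAxiom-valid
      QAx-valid (there φ∈)  = baseAxiom φ∈

    numeral-+ : ∀ a b → ⌜ a + b ⌝ ≡ add ⌜ a ⌝ ⌜ b ⌝
    numeral-+ zero    b = sym (zero-add ⌜ b ⌝)
    numeral-+ (suc a) b = trans (cong s (numeral-+ a b)) (sym (suc-add ⌜ a ⌝ ⌜ b ⌝))

    numeral-* : ∀ a b → ⌜ a * b ⌝ ≡ mul ⌜ a ⌝ ⌜ b ⌝
    numeral-* zero    b = sym (zero-mul ⌜ b ⌝)
    numeral-* (suc a) b = begin
      ⌜ b + a * b ⌝              ≡⟨ numeral-+ b (a * b) ⟩
      add ⌜ b ⌝ ⌜ a * b ⌝        ≡⟨ cong (add ⌜ b ⌝) (numeral-* a b) ⟩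
      add ⌜ b ⌝ (mul ⌜ a ⌝ ⌜ b ⌝) ≡⟨ sym (suc-mul ⌜ a ⌝ ⌜ b ⌝) ⟩
      mul ⌜ suc a ⌝ ⌜ b ⌝        ∎
      where open ≡-Reasoning

    numeral-injective : ∀ a b → ⌜ a ⌝ ≡ ⌜ b ⌝ → a ≡ b
    numeral-injective zero    zero    _  = refl
    numeral-injective zero    (suc b) eq = ⊥-elim (zero≢suc _ eq)
    numeral-injective (suc a) zero    eq = ⊥-elim (zero≢suc _ (sym eq))
    numeral-injective (suc a) (suc b) eq = cong suc (numeral-injective a b (suc-injective _ _ eq))

    add≡numeral⇒standard : ∀ n k m → add k m ≡ ⌜ n ⌝ →
      Σ ℕ λ a → Σ ℕ λ b → ⌜ a ⌝ ≡ k × ⌜ b ⌝ ≡ m × a + b ≡ n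
    add≡numeral⇒standard n k m eq with zero-or-suc k
    ... | inj₁ refl = 0 , n , refl , trans (sym eq) (zero-add m) , refl
    add≡numeral⇒standard zero    k m eq | inj₂ (y , refl) =
      ⊥-elim (zero≢suc _ (trans (sym eq) (suc-add y m)))
    add≡numeral⇒standard (suc n) k m eq | inj₂ (y , refl)
      with add≡numeral⇒standard n y m (suc-injective _ _ (trans (sym (suc-add y m)) eq))
    ... | a , b , a≡y , b≡m , a+b≡n = suc a , b , cong s a≡y , b≡m , cong suc a+b≡n

    <ᴹ-numeral⇒standard : ∀ {u} n → u <ᴹ ⌜ n ⌝ → Σ ℕ λ a → ⌜ a ⌝ ≡ u × a < n
    <ᴹ-numeral⇒standard {u} n (k , eq) with add≡numeral⇒standard n (s u) k eq
    ... | zero  , _ , 0≡su  , _ , _      = ⊥-elim (zero≢suc u 0≡su)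
    ... | suc a , b , sa≡su , _ , a+b≡n =
      a , suc-injective _ _ sa≡su , subst (suc a ≤_) a+b≡n (m≤m+n (suc a) b)

    numeral<ᴹnonstandard : ∀ n {e} → ¬ std M e → ⌜ n ⌝ <ᴹ e
    numeral<ᴹnonstandard n {e} nonstd with zero-or-suc e
    ... | inj₁ refl = ⊥-elim (nonstd (0 , refl))
    numeral<ᴹnonstandard zero    nonstd | inj₂ (y , refl) = y , trans (suc-add z y) (cong s (zero-add y))
    numeral<ᴹnonstandard (suc n) nonstd | inj₂ (y , refl)
      with numeral<ᴹnonstandard n {y} (λ (m , ⌜m⌝≡y) → nonstd (suc m , cong s ⌜m⌝≡y))
    ... | k , eq = k , trans (suc-add _ k) (cong s eq)

    numeral-∣ᴹ⇔ : ∀ d c → ⌜ d ⌝ ∣ᴹ ⌜ c ⌝ ⇔ d ∣ c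
    numeral-∣ᴹ⇔ d c = mk⇔ (reflect d) λ (divides q c≡qd) →
      ⌜ q ⌝ , trans (sym (numeral-* d q)) (cong ⌜_⌝ (trans (*-comm d q) (sym c≡qd)))
      where
      reflect : ∀ d → ⌜ d ⌝ ∣ᴹ ⌜ c ⌝ → d ∣ c
      reflect zero (k , eq) = subst (0 ∣_) (numeral-injective 0 c (trans (sym (zero-mul k)) eq)) ∣-refl
      reflect (suc a) (k , eq)
        with add≡numeral⇒standard c k (mul ⌜ a ⌝ k) (trans (sym (suc-mul ⌜ a ⌝ k)) eq)
      ... | q , b , q≡k , b≡ak , q+b≡c = divides q (begin
        c             ≡⟨ sym q+b≡c ⟩
        q + b         ≡⟨ cong (q +_) (sym a*q≡b) ⟩
        suc a * q     ≡⟨ *-comm (suc a) q ⟩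
        q * suc a     ∎)
        where
        open ≡-Reasoning
        a*q≡b : a * q ≡ b
        a*q≡b = numeral-injective _ _ (trans (numeral-* a q) (trans (cong (mul ⌜ a ⌝) q≡k) (sym b≡ak)))

    allStandard⇒IsoToℕ : (∀ x → std M x) → IsoToℕ M
    allStandard⇒IsoToℕ allStandard =
      ⌜_⌝ , refl , (λ _ → refl) , numeral-+ , numeral-* , numeral-injective , allStandard

    overspill : Stable (std M) → ¬ IsoToℕ M → ∀ ψ ρ → (∀ n → (⌜ n ⌝ ◂ ρ) ⊨ ψ) →
                ¬ ¬ Σ D λ e → (e ◂ ρ) ⊨ ψ × ¬ std M e
    overspill stable ¬iso ψ ρ ψ-numerals ¬nonstandard = ¬iso (allStandard⇒IsoToℕ allStandard)
      where
      ψ⇒standard : ∀ x → (x ◂ ρ) ⊨ ψ → std M x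
      ψ⇒standard x ψx = stable x λ nonstd → ¬nonstandard (x , ψx , nonstd)

      ψ-step : ∀ d → (d ◂ ρ) ⊨ ψ → (s d ◂ ρ) ⊨ ψ
      ψ-step d ψd with ψ⇒standard d ψd
      ... | n , refl = ψ-numerals (suc n)

      allStandard : ∀ x → std M x
      allStandard x = ψ⇒standard x (induction ψ ρ (ψ-numerals 0) ψ-step x)

    Q-represents⇒Represents : ∀ φ g → (∀ n → Q⊢ (∀' (fsubst (repσ n) φ ⇔' (num (g n) == var zero)))) →
                              Represents φ g
    Q-represents⇒Represents φ g Q⊢rep n y with Q-soundness (Q⊢rep n) ρ₀ y
    ... | φ⇒gn≡y , gn≡y⇒φ =
      ⇔-trans (⇔-sym (sat-fsubst φ repσ≡))
              (mk⇔ (λ φy → trans (sym (φ⇒gn≡y φy)) gn≡) (λ y≡gn → gn≡y⇒φ (trans gn≡ (sym y≡gn))))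
      where
      gn≡ : ⟦ num (g n) ⟧ (y ◂ ρ₀) ≡ ⌜ g n ⌝
      gn≡ = eval-num (g n) (y ◂ ρ₀)
      repσ≡ : ∀ m → ⟦ repσ n m ⟧ (y ◂ ρ₀) ≡ (y ◂ ⌜ n ⌝ ◂ ρ₀) m
      repσ≡ zero          = refl
      repσ≡ (suc zero)    = eval-num n _
      repσ≡ (suc (suc m)) = refl

    module PrimeCoding (π : ℕ → ℕ) (π-injective : ∀ m n → π m ≡ π n → m ≡ n)
                       (π-prime : ∀ n → Prime (π n)) (f : ℕ → Bool)
                       (φπ : Form) (repπ : Represents φπ π)
                       (φp : Form) (repp : Represents φp (indicator f)) where
      open Coding π π-injective π-prime f
      open EquationalReasoning {k = equivalence}

      -- c codes the set {u < x ∣ p u} by the primes π u dividing it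
      Codes : D → D → Set
      Codes x c = ∀ u → u <ᴹ x → ∀ y → (y ◂ u ◂ ρ₀) ⊨ φπ → (y ∣ᴹ c ⇔ (⌜ 1 ⌝ ◂ u ◂ ρ₀) ⊨ φp)

      -- Φ(x) = ∃c ∀u. u < x → ∀y. φπ(u, y) → (y ∣ c ↔ φp(u, 1)); innermost, v0 … v3 are y, u, c, x
      codeFormula : Form
      codeFormula = ∃' (∀' (v0 <' v2 ⇒ ∀' (fsubst (args₂ v1 v0) φπ ⇒
                                          (v0 ∣' v2 ⇔' fsubst (args₂ v1 (num 1)) φp))))

      codeFormula-intro : ∀ {x c} → Codes x c → (x ◂ ρ₀) ⊨ codeFormula
      codeFormula-intro {c = c} codes = c , λ u u<x y φπ[u,y] →
        let y∣c⇔ = codes u u<x y (to (sat-args₂ φπ v1 v0 _) φπ[u,y])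
        in from (sat-args₂ φp v1 (num 1) _) ∘ to y∣c⇔ , from y∣c⇔ ∘ to (sat-args₂ φp v1 (num 1) _)

      codeFormula-elim : ∀ {x} → (x ◂ ρ₀) ⊨ codeFormula → Σ D (Codes x)
      codeFormula-elim (c , Φc) = c , λ u u<x y φπ[u,y] →
        let (y∣c⇒ , ⇒y∣c) = Φc u u<x y (from (sat-args₂ φπ v1 v0 _) φπ[u,y])
        in mk⇔ (to (sat-args₂ φp v1 (num 1) _) ∘ y∣c⇒) (⇒y∣c ∘ from (sat-args₂ φp v1 (num 1) _))

      φp[n,1]⇔ : ∀ n → (⌜ 1 ⌝ ◂ ⌜ n ⌝ ◂ ρ₀) ⊨ φp ⇔ f n ≡ true
      φp[n,1]⇔ n = begin
        (⌜ 1 ⌝ ◂ ⌜ n ⌝ ◂ ρ₀) ⊨ φp   ∼⟨ repp n ⌜ 1 ⌝ ⟩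
        ⌜ 1 ⌝ ≡ ⌜ indicator f n ⌝   ∼⟨ mk⇔ (numeral-injective 1 _) (cong ⌜_⌝) ⟩
        1 ≡ indicator f n           ∼⟨ 1≡indicator⇔ f n ⟩
        f n ≡ true                  ∎

      standard-codes : ∀ n → Codes ⌜ n ⌝ ⌜ code n ⌝
      standard-codes n u u<n y φπ[u,y] with <ᴹ-numeral⇒standard n u<n
      ... | a , refl , a<n with to (repπ a y) φπ[u,y]
      ... | refl = begin
        ⌜ π a ⌝ ∣ᴹ ⌜ code n ⌝        ∼⟨ numeral-∣ᴹ⇔ (π a) (code n) ⟩
        π a ∣ code n                 ∼⟨ π∣code⇔ a n ⟩
        (a < n × f a ≡ true)         ∼⟨ mk⇔ proj₂ (a<n ,_) ⟩
        f a ≡ true                   ∼⟨ ⇔-sym (φp[n,1]⇔ a) ⟩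
        (⌜ 1 ⌝ ◂ ⌜ a ⌝ ◂ ρ₀) ⊨ φp    ∎

      nonstandard-codes : ∀ {e c} → Codes e c → ¬ std M e → ∀ n → ⌜ π n ⌝ ∣ᴹ c ⇔ f n ≡ true
      nonstandard-codes codes nonstd n =
        ⇔-trans (codes ⌜ n ⌝ (numeral<ᴹnonstandard n nonstd) ⌜ π n ⌝ (from (repπ n _) refl))
                (φp[n,1]⇔ n)

      ¬¬∃prime-code : Stable (std M) → ¬ IsoToℕ M → ¬ ¬ Σ D λ c → ∀ n → ⌜ π n ⌝ ∣ᴹ c ⇔ f n ≡ true
      ¬¬∃prime-code stable ¬iso =
        ¬¬-map nonstandard-code (overspill stable ¬iso codeFormula ρ₀ (codeFormula-intro ∘ standard-codes))
        where
        nonstandard-code : (Σ D λ e → (e ◂ ρ₀) ⊨ codeFormula × ¬ std M e) →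
                           Σ D λ c → ∀ n → ⌜ π n ⌝ ∣ᴹ c ⇔ f n ≡ true
        nonstandard-code (e , Φe , nonstd) with codeFormula-elim Φe
        ... | c , codes = c , nonstandard-codes codes nonstd

lemma7p4 : CT-Q → (π : ℕ → ℕ) → (∀ m n → π m ≡ π n → m ≡ n) → (∀ n → Prime (π n)) →
           (M : Model) → IsHAModel M → Stable (std M) → ¬ IsoToℕ M →
           (p : ℕ → Set) → DecidablePred p →
           ¬ ¬ (Σ (Model.D M) λ c → ∀ n →
                  p n ⇔ sat M (λ _ → c) (num (π n) ∣' var 0))
lemma7p4 ct π π-injective π-prime M HA stable ¬iso p (f , p⇔f) =
  ¬¬-map (λ (c , π∣c⇔) → c , λ n →
            ⇔-trans (p⇔f n) (⇔-sym (⇔-trans (sat-numeral-∣' M (π n) (var 0) _) (π∣c⇔ n))))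
         (¬¬∃prime-code stable ¬iso)
  where
  -- only the Q-provable representation is used, not the Σ₁ shape or the variable bound of φ
  representation : (g : ℕ → ℕ) → Σ Form λ φ → Represents M φ g
  representation g with ct g
  ... | φ , _ , _ , Q⊢rep = φ , Q-represents⇒Represents M HA φ g Q⊢rep

  open PrimeCoding M HA π π-injective π-prime f
         (proj₁ (representation π)) (proj₂ (representation π))
         (proj₁ (representation (indicator f))) (proj₂ (representation (indicator f)))
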